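{- For every integer $d\ge 1$, the total mutual-visibility number of the $d$-dimensional butterfly satisfies $\mu_t(\mathit{BF}(d)) = 2^d$.
   Context: All graphs are finite, simple, undirected and connected; distances are shortest-path distances. For a graph $G$ and $X\subseteq V(G)$, two vertices $x,y\in V(G)$ are $X$-visible if there is a shortest $x,y$-path none of whose internal vertices lies in $X$. $X$ is a total mutual-visibility set of $G$ if every two vertices of $V(G)$ are $X$-visible; $\mu_t(G)$ is the maximum cardinality of a total mutual-visibility set of $G$. The $d$-dimensional butterfly $\mathit{BF}(d)$ has vertex set $\{[\ell,c] : \ell\in\{0,1,\dots,d\},\ c\in\{0,1\}^d\}$ ($\ell$ is the level, $c$ the column, a binary string of length $d$); for $\ell\in\{1,\dots,d\}$, the vertex $[\ell-1,c]$ is adjacent to $[\ell,c']$ if and only if either $c=c'$ or $c$ and $c'$ differ exactly in the $\ell$-th bit (bits counted from the left starting at 1); there are no other edges. -}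

module Defs where

open import Level using (Level)
open import Data.Nat using (ℕ; zero; suc; _≤_)
open import Data.Fin using (Fin; toℕ)
open import Data.Bool using (Bool)
open import Data.Vec using (Vec; lookup)
open import Data.List using (List; []; _∷_; length)
open import Data.List.Membership.Propositional using (_∈_; _∉_)
open import Data.List.Relation.Unary.All using (All)
open import Data.List.Relation.Unary.Unique.Propositional using (Unique)
open import Data.Product using (Σ; _×_; _,_)
open import Data.Sum using (_⊎_)
open import Relation.Binary.PropositionalEquality using (_≡_; _≢_)

module GraphNotions (V : Set) (Adj : V → V → Set) where

  data Walk : V → V → Set where
    nil  : (x : V) → Walk x x
    cons : {x y z : V} → Adj x y → Walk y z → Walk x z

  len : {x y : V} → Walk x y → ℕ
  len (nil _)    = 0
  len (cons _ w) = suc (len w)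

  private
    allButLast : {x y : V} → Walk x y → List V
    allButLast (nil _)            = []
    allButLast (cons {x = x} _ w) = x ∷ allButLast w

  internal : {x y : V} → Walk x y → List V
  internal (nil _)    = []
  internal (cons _ w) = allButLast w

  IsShortest : {x y : V} → Walk x y → Set
  IsShortest {x} {y} w = (w' : Walk x y) → len w ≤ len w'

  Visible : List V → V → V → Set
  Visible X x y =
    Σ (Walk x y) λ w → IsShortest w × All (λ v → v ∉ X) (internal w)

  IsTotalMutualVisibilitySet : List V → Set
  IsTotalMutualVisibilitySet X = (x y : V) → Visible X x y

  TotalMutualVisibilityNumberIs : ℕ → Set
  TotalMutualVisibilityNumberIs k =
    (Σ (List V) λ X → Unique X × IsTotalMutualVisibilitySet X × length X ≡ k)
    × ((X : List V) → Unique X → IsTotalMutualVisibilitySet X → length X ≤ k)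

-- vertex [ℓ , c]: level ℓ ∈ {0..d}, column c ∈ {0,1}^d
BFVertex : ℕ → Set
BFVertex d = Fin (suc d) × Vec Bool d

-- c and c' differ exactly in the bit with 0-based index k
-- (i.e. the (k+1)-th bit counted from the left starting at 1)
DiffExactlyAt : {d : ℕ} → ℕ → Vec Bool d → Vec Bool d → Set
DiffExactlyAt {d} k c c' =
  (j : Fin d) → (toℕ j ≡ k → lookup c j ≢ lookup c' j)
              × (toℕ j ≢ k → lookup c j ≡ lookup c' j)

-- [ℓ-1, c] — [ℓ, c'] (ℓ ∈ {1..d}) iff c = c' or they differ exactly in
-- the ℓ-th bit; here the lower level is ℓ-1 = toℕ l, so the bit has
-- 0-based index toℕ l.
BFEdge : (d : ℕ) → BFVertex d → BFVertex d → Set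
BFEdge d (l , c) (l' , c') =
  toℕ l' ≡ suc (toℕ l) × (c ≡ c' ⊎ DiffExactlyAt (toℕ l) c c')

BFAdj : (d : ℕ) → BFVertex d → BFVertex d → Set
BFAdj d u v = BFEdge d u v ⊎ BFEdge d v u

module BF (d : ℕ) = GraphNotions (BFVertex d) (BFAdj d)

module Submission where

-- Lower bound: X₀ consists of the level-0 vertices whose first bit is 0 and the level-d
-- vertices whose last bit is 0. All edges at such a vertex change only that bit, so setting
-- it to 1 yields a vertex outside X₀ with the same neighbours, and every shortest path can
-- be rerouted around X₀.
-- Upper bound: [l-1, c] and [l+1, c] have [l, c] as their only common neighbour, so a total
-- mutual-visibility set X contains no vertex of an interior level. Likewise two boundary
-- vertices differing only in their boundary bit are the only common neighbours of their two
-- inner-level neighbours, so they are not both in X. Hence recording the side and forgetting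
-- the boundary bit maps X injectively into {0,1}^d.

open import Defs
open import Data.Nat using (ℕ; zero; suc; _+_; _⊓_; _≤_; _<_; _^_; z≤n; s≤s) renaming (_≟_ to _≟ℕ_)
open import Data.Nat.Properties
  using ( m≢1+n+m; 1+n≢n; n≮n; ≮⇒≥; ≤∧≢⇒<; ≤⇒≯; suc-injective; +-identityʳ; n≤1+n
        ; m≤n⇒m⊓n≡m; m≥n⇒m⊓n≡n; ⊓-comm; ⊓-zeroʳ; anyUpTo?; module ≤-Reasoning)
open import Data.Nat.Induction using (<-wellFounded)
open import Induction.WellFounded using (Acc; acc)
open import Data.Fin as Fin using (Fin; toℕ; fromℕ; inject₁; lower₁; punchOut)
import Data.Fin.Properties as Finₚ
open import Data.Bool using (Bool; true; false)
import Data.Bool.Properties as Boolₚ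
open import Data.Vec as Vec using (Vec; []; _∷_; lookup; _[_]≔_; insertAt; removeAt)
import Data.Vec.Properties as Vecₚ
open import Data.List using (List; []; _∷_; length; _++_; map; cartesianProduct; allFin)
open import Data.List.Properties using (length-++; length-map)
open import Data.List.Membership.Propositional using (_∈_; _∉_; lose)
import Data.List.Membership.Propositional.Properties as ∈ₚ
import Data.List.Membership.DecPropositional as DecMembership
open import Data.List.Relation.Unary.Any as Any using (here; there; _─_)
open import Data.List.Relation.Unary.All as All using (All; []; _∷_)
import Data.List.Relation.Unary.All.Properties as Allₚ
open import Data.List.Relation.Unary.AllPairs using ([]; _∷_)
open import Data.List.Relation.Unary.Unique.Propositional using (Unique)
import Data.List.Relation.Unary.Unique.Propositional.Properties as Uniqueₚ
open import Data.Product using (Σ; ∃; _×_; _,_; proj₁; proj₂)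
import Data.Product.Properties as Productₚ
open import Data.Sum using (_⊎_; inj₁; inj₂)
open import Function using (_∘_)
open import Relation.Nullary using (¬_; Dec; yes; no; contradiction)
open import Relation.Nullary.Decidable using (map′; _×-dec_; _⊎-dec_; _→-dec_; ¬?)
open import Relation.Binary.Definitions using (DecidableEquality)
open import Relation.Binary.PropositionalEquality
  using (_≡_; _≢_; refl; sym; trans; cong; cong₂; subst; module ≡-Reasoning)

module _ {A : Set} where

  ∈-─⁺ : ∀ {x z : A} {ys} (p : x ∈ ys) → z ∈ ys → z ≢ x → z ∈ (ys ─ p)
  ∈-─⁺ (here refl) (here refl) z≢x = contradiction refl z≢x
  ∈-─⁺ (here refl) (there q)   _   = q
  ∈-─⁺ (there p)   (here refl) _   = here refl
  ∈-─⁺ (there p)   (there q)   z≢x = there (∈-─⁺ p q z≢x)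

  length-─ : ∀ {x : A} {ys} (p : x ∈ ys) → suc (length (ys ─ p)) ≡ length ys
  length-─ (here _)  = refl
  length-─ (there p) = cong suc (length-─ p)

  Unique⇒length≤ : ∀ {xs ys : List A} → Unique xs → (∀ {z} → z ∈ xs → z ∈ ys) → length xs ≤ length ys
  Unique⇒length≤ {[]}     _            _   = z≤n
  Unique⇒length≤ {x ∷ xs} {ys} (x∉xs ∷ xs!) xs⊆ys =
    subst (suc (length xs) ≤_) (length-─ x∈ys) (s≤s (Unique⇒length≤ xs! xs⊆ys─x))
    where
    x∈ys = xs⊆ys (here refl)
    xs⊆ys─x : ∀ {z} → z ∈ xs → z ∈ (ys ─ x∈ys)
    xs⊆ys─x z∈xs = ∈-─⁺ x∈ys (xs⊆ys (there z∈xs)) (λ z≡x → All.lookup x∉xs z∈xs (sym z≡x))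

Unique-map⁺-injectiveOn : ∀ {A B : Set} (f : A → B) {xs : List A} →
  (∀ {a b} → a ∈ xs → b ∈ xs → f a ≡ f b → a ≡ b) → Unique xs → Unique (map f xs)
Unique-map⁺-injectiveOn f {[]}     _   []             = []
Unique-map⁺-injectiveOn f {x ∷ xs} inj (x∉xs ∷ xs!) =
  Allₚ.map⁺ (All.tabulate λ {z} z∈xs fx≡fz → All.lookup x∉xs z∈xs (inj (here refl) (there z∈xs) fx≡fz))
  ∷ Unique-map⁺-injectiveOn f (λ a∈ b∈ → inj (there a∈) (there b∈)) xs!

allVecs : ∀ n → List (Vec Bool n)
allVecs zero    = [] ∷ []
allVecs (suc n) = map (false ∷_) (allVecs n) ++ map (true ∷_) (allVecs n)

length-allVecs : ∀ n → length (allVecs n) ≡ 2 ^ n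
length-allVecs zero    = refl
length-allVecs (suc n) = begin
  length (map (false ∷_) (allVecs n) ++ map (true ∷_) (allVecs n))
    ≡⟨ length-++ (map (false ∷_) (allVecs n)) ⟩
  length (map (false ∷_) (allVecs n)) + length (map (true ∷_) (allVecs n))
    ≡⟨ cong₂ _+_ (length-map (false ∷_) (allVecs n)) (length-map (true ∷_) (allVecs n)) ⟩
  length (allVecs n) + length (allVecs n)
    ≡⟨ cong₂ _+_ (length-allVecs n) (trans (length-allVecs n) (sym (+-identityʳ (2 ^ n)))) ⟩
  2 ^ suc n ∎
  where open ≡-Reasoning

∈-allVecs : ∀ {n} (v : Vec Bool n) → v ∈ allVecs n
∈-allVecs []          = here refl
∈-allVecs (false ∷ v) = ∈ₚ.∈-++⁺ˡ (∈ₚ.∈-map⁺ (false ∷_) (∈-allVecs v))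
∈-allVecs {suc n} (true ∷ v) =
  ∈ₚ.∈-++⁺ʳ (map (false ∷_) (allVecs n)) (∈ₚ.∈-map⁺ (true ∷_) (∈-allVecs v))

allVecs-unique : ∀ n → Unique (allVecs n)
allVecs-unique zero    = [] ∷ []
allVecs-unique (suc n) =
  Uniqueₚ.++⁺ (Uniqueₚ.map⁺ Vecₚ.∷-injectiveʳ (allVecs-unique n))
              (Uniqueₚ.map⁺ Vecₚ.∷-injectiveʳ (allVecs-unique n))
              disjoint
  where
  disjoint : ∀ {v} → ¬ (v ∈ map (false ∷_) (allVecs n) × v ∈ map (true ∷_) (allVecs n))
  disjoint (p , q) with ∈ₚ.∈-map⁻ (false ∷_) p | ∈ₚ.∈-map⁻ (true ∷_) q
  ... | _ , _ , refl | _ , _ , ()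

module GraphProperties (V : Set) (Adj : V → V → Set) where
  open GraphNotions V Adj

  _++ʷ_ : ∀ {x y z} → Walk x y → Walk y z → Walk x z
  nil _    ++ʷ w′ = w′
  cons e w ++ʷ w′ = cons e (w ++ʷ w′)

  reverseʷ : (∀ {x y} → Adj x y → Adj y x) → ∀ {x y} → Walk x y → Walk y x
  reverseʷ adj-sym (nil x)    = nil x
  reverseʷ adj-sym (cons e w) = reverseʷ adj-sym w ++ʷ cons (adj-sym e) (nil _)

  -- A shortest x,u-walk has length 2, so its single internal vertex is the neighbour sought.
  commonNeighbour∉ : ∀ {X} → IsTotalMutualVisibilitySet X → ∀ {x u v} → x ≢ u → ¬ Adj x u →
                     Adj x v → Adj v u → ∃ λ v′ → Adj x v′ × Adj v′ u × v′ ∉ X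
  commonNeighbour∉ {X} tmv {x} {u} {v} x≢u x≁u x~v v~u with tmv x u
  ... | nil _                           , _        , _          = contradiction refl x≢u
  ... | cons x~u (nil _)                , _        , _          = contradiction x~u x≁u
  ... | cons x~v′ (cons v′~u (nil _))   , _        , v′∉X ∷ []  = _ , x~v′ , v′~u , v′∉X
  ... | cons _ (cons _ (cons _ _))      , shortest , _          with shortest (cons x~v (cons v~u (nil u)))
  ...   | s≤s (s≤s ())

  module ShortestWalks (_≟_ : DecidableEquality V) (adj? : ∀ x y → Dec (Adj x y))
                       (vertices : List V) (∈-vertices : ∀ v → v ∈ vertices) where

    WalkOfLength : ℕ → V → V → Set
    WalkOfLength n x y = Σ (Walk x y) λ w → len w ≡ n

    ∃-vertex? : {P : V → Set} → (∀ v → Dec (P v)) → Dec (∃ P)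
    ∃-vertex? P? = map′ Any.satisfied (λ (v , pv) → lose (∈-vertices v) pv) (Any.any? P? vertices)

    walkOfLength? : ∀ n x y → Dec (WalkOfLength n x y)
    walkOfLength? zero x y with x ≟ y
    ... | yes refl = yes (nil x , refl)
    ... | no x≢y   = no λ { (nil _ , _) → x≢y refl ; (cons _ _ , ()) }
    walkOfLength? (suc n) x y = map′ extend restrict (∃-vertex? λ v → adj? x v ×-dec walkOfLength? n v y)
      where
      extend : (∃ λ v → Adj x v × WalkOfLength n v y) → WalkOfLength (suc n) x y
      extend (_ , e , w , refl) = cons e w , refl
      restrict : WalkOfLength (suc n) x y → ∃ λ v → Adj x v × WalkOfLength n v y
      restrict (cons e w , eq) = _ , e , w , suc-injective eq

    shortestWalk : ∀ {x y} → Walk x y → Σ (Walk x y) IsShortest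
    shortestWalk w = go w (<-wellFounded (len w))
      where
      go : ∀ {x y} (w : Walk x y) → Acc _<_ (len w) → Σ (Walk x y) IsShortest
      go {x} {y} w (acc shorter) with anyUpTo? (λ n → walkOfLength? n x y) (len w)
      ... | yes (_ , n<len , w′ , refl) = go w′ (shorter n<len)
      ... | no none = w , λ w′ → ≮⇒≥ λ lt → none (len w′ , lt , w′ , refl)

  -- If every vertex of X has a substitute outside X whose neighbourhood contains its own,
  -- internal vertices of any walk can be swapped out of X without lengthening it.
  module Rerouting (_≟_ : DecidableEquality V) (adj-sym : ∀ {x y} → Adj x y → Adj y x)
                   (X : List V)
                   (substitute : ∀ {y} → y ∈ X → ∃ λ y* → y* ∉ X × (∀ {x} → Adj x y → Adj x y*)) where

    open DecMembership _≟_ using (_∈?_)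

    Avoiding : ∀ {x y} → Walk x y → Set
    Avoiding w = All (_∉ X) (internal w)

    prepend : ∀ {x y z} → Adj x y → (w : Walk y z) → Avoiding w →
              Σ (Walk x z) λ w′ → len w′ ≡ suc (len w) × Avoiding w′
    prepend e (nil _) _ = cons e (nil _) , refl , []
    prepend {y = y} e (cons e′ w) avoids with y ∈? X
    ... | no y∉X  = cons e (cons e′ w) , refl , y∉X ∷ avoids
    ... | yes y∈X with substitute y∈X
    ...   | y* , y*∉X , ~y⇒~y* =
      cons (~y⇒~y* e) (cons (adj-sym (~y⇒~y* (adj-sym e′))) w) , refl , y*∉X ∷ avoids

    reroute : ∀ {x y} (w : Walk x y) → Σ (Walk x y) λ w′ → len w′ ≡ len w × Avoiding w′
    reroute (nil x) = nil x , refl , []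
    reroute (cons e w) with reroute w
    ... | w₁ , eq₁ , avoids₁ with prepend e w₁ avoids₁
    ...   | w₂ , eq₂ , avoids₂ = w₂ , trans eq₂ (cong suc eq₁) , avoids₂

    totalMutualVisibility : (∀ x y → Σ (Walk x y) IsShortest) → IsTotalMutualVisibilitySet X
    totalMutualVisibility shortest x y with shortest x y
    ... | w , w-shortest with reroute w
    ...   | w′ , eq , avoids = w′ , (λ w″ → subst (_≤ len w″) (sym eq) (w-shortest w″)) , avoids

lookup-ext : ∀ {A : Set} {n} {a b : Vec A n} → (∀ j → lookup a j ≡ lookup b j) → a ≡ b
lookup-ext {a = a} {b} pointwise = begin
  a                   ≡⟨ Vecₚ.tabulate∘lookup a ⟨
  Vec.tabulate (lookup a) ≡⟨ Vecₚ.tabulate-cong pointwise ⟩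
  Vec.tabulate (lookup b) ≡⟨ Vecₚ.tabulate∘lookup b ⟩
  b                   ∎
  where open ≡-Reasoning

record AgreeExcept {n} (k : ℕ) (a b : Vec Bool n) : Set where
  constructor agreeExcept
  field lookup-agree : ∀ j → toℕ j ≢ k → lookup a j ≡ lookup b j

open AgreeExcept

module _ {n k : ℕ} where

  agreeExcept-refl : ∀ {a : Vec Bool n} → AgreeExcept k a a
  agreeExcept-refl = agreeExcept λ _ _ → refl

  agreeExcept-sym : ∀ {a b : Vec Bool n} → AgreeExcept k a b → AgreeExcept k b a
  agreeExcept-sym a~b = agreeExcept λ j j≢k → sym (lookup-agree a~b j j≢k)

  agreeExcept-trans : ∀ {a b c : Vec Bool n} → AgreeExcept k a b → AgreeExcept k b c → AgreeExcept k a c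
  agreeExcept-trans a~b b~c = agreeExcept λ j j≢k → trans (lookup-agree a~b j j≢k) (lookup-agree b~c j j≢k)

  agreeExcept⇒≡ : ∀ {a b : Vec Bool n} → AgreeExcept k a b →
                  (∀ j → toℕ j ≡ k → lookup a j ≡ lookup b j) → a ≡ b
  agreeExcept⇒≡ {a} {b} a~b atK = lookup-ext pointwise
    where
    pointwise : ∀ j → lookup a j ≡ lookup b j
    pointwise j with toℕ j ≟ℕ k
    ... | yes j≡k = atK j j≡k
    ... | no  j≢k = lookup-agree a~b j j≢k

  agreeExcept? : ∀ (a b : Vec Bool n) → Dec (AgreeExcept k a b)
  agreeExcept? a b = map′ agreeExcept lookup-agree
    (Finₚ.all? λ j → ¬? (toℕ j ≟ℕ k) →-dec (lookup a j Boolₚ.≟ lookup b j))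

  agreeExcept-atBit⇒≡ : ∀ {a b : Vec Bool n} → AgreeExcept k a b →
                        ∀ j → toℕ j ≡ k → lookup a j ≡ lookup b j → a ≡ b
  agreeExcept-atBit⇒≡ {a} {b} a~b j j≡k aⱼ≡bⱼ = agreeExcept⇒≡ a~b atK
    where
    atK : ∀ i → toℕ i ≡ k → lookup a i ≡ lookup b i
    atK i i≡k rewrite Finₚ.toℕ-injective (trans i≡k (sym j≡k)) = aⱼ≡bⱼ

  -- A bit takes only two values.
  agreeExcept-dichotomy : ∀ {v c c′ : Vec Bool n} → AgreeExcept k v c → AgreeExcept k c c′ → c ≢ c′ →
                          v ≡ c ⊎ v ≡ c′
  agreeExcept-dichotomy {v} {c} {c′} v~c c~c′ c≢c′ with Vecₚ.≡-dec Boolₚ._≟_ v c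
  ... | yes v≡c = inj₁ v≡c
  ... | no  v≢c = inj₂ (agreeExcept⇒≡ (agreeExcept-trans v~c c~c′) atK)
    where
    atK : ∀ j → toℕ j ≡ k → lookup v j ≡ lookup c′ j
    atK j j≡k = trans (Boolₚ.¬-not λ vⱼ≡cⱼ → v≢c (agreeExcept-atBit⇒≡ v~c j j≡k vⱼ≡cⱼ))
                      (sym (Boolₚ.¬-not λ c′ⱼ≡cⱼ → c≢c′ (agreeExcept-atBit⇒≡ c~c′ j j≡k (sym c′ⱼ≡cⱼ))))

agreeExcept-twoBits : ∀ {n m k} {a b : Vec Bool n} → AgreeExcept m a b → AgreeExcept k a b → m ≢ k → a ≡ b
agreeExcept-twoBits a~b a≈b m≢k =
  agreeExcept⇒≡ a~b λ j j≡m → lookup-agree a≈b j λ j≡k → m≢k (trans (sym j≡m) j≡k)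

agreeExcept-reindex : ∀ {n k k′} {a b : Vec Bool n} → k ≡ k′ → AgreeExcept k a b → AgreeExcept k′ a b
agreeExcept-reindex refl a~b = a~b

update-agreeExcept : ∀ {n} (a : Vec Bool n) k x → AgreeExcept (toℕ k) a (a [ k ]≔ x)
update-agreeExcept a k x =
  agreeExcept λ j j≢k → sym (Vecₚ.lookup∘update′ (λ j≡k → j≢k (cong toℕ j≡k)) a x)

removeAt-≡⇒agreeExcept : ∀ {n} (a b : Vec Bool (suc n)) k →
                         removeAt a k ≡ removeAt b k → AgreeExcept (toℕ k) a b
removeAt-≡⇒agreeExcept a b k eq = agreeExcept λ j j≢k → agreeOff j λ k≡j → j≢k (cong toℕ (sym k≡j))
  where
  open ≡-Reasoning
  agreeOff : ∀ j → k ≢ j → lookup a j ≡ lookup b j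
  agreeOff j k≢j = begin
    lookup a j                           ≡⟨ Vecₚ.removeAt-punchOut a k≢j ⟨
    lookup (removeAt a k) (punchOut k≢j) ≡⟨ cong (λ v → lookup v (punchOut k≢j)) eq ⟩
    lookup (removeAt b k) (punchOut k≢j) ≡⟨ Vecₚ.removeAt-punchOut b k≢j ⟩
    lookup b j                           ∎

Consecutive : ℕ → ℕ → Set
Consecutive m n = n ≡ suc m ⊎ m ≡ suc n

consecutive-irrefl : ∀ {m} → ¬ Consecutive m m
consecutive-irrefl (inj₁ ())
consecutive-irrefl (inj₂ ())

consecutive-sym : ∀ {m n} → Consecutive m n → Consecutive n m
consecutive-sym (inj₁ eq) = inj₂ eq
consecutive-sym (inj₂ eq) = inj₁ eq

consecutive-2+ : ∀ {m} → ¬ Consecutive m (suc (suc m))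
consecutive-2+ (inj₁ ())
consecutive-2+ (inj₂ ())

consecutive-between : ∀ {a v} → Consecutive a v → Consecutive v (suc (suc a)) → v ≡ suc a
consecutive-between (inj₁ refl) _ = refl
consecutive-between (inj₂ refl) (inj₁ ())
consecutive-between (inj₂ refl) (inj₂ ())

⊓-≡suc : ∀ {m n} → n ≡ suc m → m ⊓ n ≡ m
⊓-≡suc refl = m≤n⇒m⊓n≡m (n≤1+n _)

≡suc-⊓ : ∀ {m n} → m ≡ suc n → m ⊓ n ≡ n
≡suc-⊓ refl = m≥n⇒m⊓n≡n (n≤1+n _)

consecutive-⊓-injective : ∀ {m a b} → Consecutive m a → Consecutive m b → m ⊓ a ≡ m ⊓ b → a ≡ b
consecutive-⊓-injective (inj₁ refl) (inj₁ refl) _  = refl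
consecutive-⊓-injective (inj₂ refl) (inj₂ refl) _  = refl
consecutive-⊓-injective (inj₁ refl) (inj₂ refl) eq =
  contradiction (trans (sym (⊓-≡suc refl)) (trans eq (≡suc-⊓ refl))) 1+n≢n
consecutive-⊓-injective (inj₂ refl) (inj₁ refl) eq =
  contradiction (trans (sym (≡suc-⊓ refl)) (trans eq (⊓-≡suc refl))) (1+n≢n ∘ sym)

module Butterfly (d : ℕ) where
  open BF d
  open GraphProperties (BFVertex d) (BFAdj d)

  bottom top : Fin (suc d)
  bottom = Fin.zero
  top    = fromℕ d

  edge⇒agreeExcept : ∀ {l l′ c c′} → BFEdge d (l , c) (l′ , c′) →
                     toℕ l′ ≡ suc (toℕ l) × AgreeExcept (toℕ l) c c′
  edge⇒agreeExcept (l′≡1+l , inj₁ refl) = l′≡1+l , agreeExcept-refl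
  edge⇒agreeExcept (l′≡1+l , inj₂ diff) = l′≡1+l , agreeExcept λ j → proj₂ (diff j)

  agreeExcept⇒edge : ∀ {l l′ c c′} → toℕ l′ ≡ suc (toℕ l) → AgreeExcept (toℕ l) c c′ →
                     BFEdge d (l , c) (l′ , c′)
  agreeExcept⇒edge {c = c} {c′} l′≡1+l c~c′ with Vecₚ.≡-dec Boolₚ._≟_ c c′
  ... | yes c≡c′ = l′≡1+l , inj₁ c≡c′
  ... | no  c≢c′ =
    l′≡1+l , inj₂ λ j → (λ j≡l cⱼ≡c′ⱼ → c≢c′ (agreeExcept-atBit⇒≡ c~c′ j j≡l cⱼ≡c′ⱼ)) , lookup-agree c~c′ j

  adj⇒consecutive : ∀ {l l′ c c′} → BFAdj d (l , c) (l′ , c′) → Consecutive (toℕ l) (toℕ l′)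
  adj⇒consecutive (inj₁ e) = inj₁ (proj₁ (edge⇒agreeExcept e))
  adj⇒consecutive (inj₂ e) = inj₂ (proj₁ (edge⇒agreeExcept e))

  -- An edge between levels m and m + 1 may only change bit m = m ⊓ (m + 1).
  adj⇒agreeExcept : ∀ {l l′ c c′} → BFAdj d (l , c) (l′ , c′) → AgreeExcept (toℕ l ⊓ toℕ l′) c c′
  adj⇒agreeExcept (inj₁ e) with edge⇒agreeExcept e
  ... | l′≡1+l , c~c′ = agreeExcept-reindex (sym (⊓-≡suc l′≡1+l)) c~c′
  adj⇒agreeExcept (inj₂ e) with edge⇒agreeExcept e
  ... | l≡1+l′ , c′~c = agreeExcept-reindex (sym (≡suc-⊓ l≡1+l′)) (agreeExcept-sym c′~c)

  consecutive⇒adj : ∀ {l l′ c c′} → Consecutive (toℕ l) (toℕ l′) → AgreeExcept (toℕ l ⊓ toℕ l′) c c′ →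
                    BFAdj d (l , c) (l′ , c′)
  consecutive⇒adj (inj₁ l′≡1+l) c~c′ =
    inj₁ (agreeExcept⇒edge l′≡1+l (agreeExcept-reindex (⊓-≡suc l′≡1+l) c~c′))
  consecutive⇒adj (inj₂ l≡1+l′) c~c′ =
    inj₂ (agreeExcept⇒edge l≡1+l′ (agreeExcept-reindex (≡suc-⊓ l≡1+l′) (agreeExcept-sym c~c′)))

  adj-sym : ∀ {u v} → BFAdj d u v → BFAdj d v u
  adj-sym (inj₁ e) = inj₂ e
  adj-sym (inj₂ e) = inj₁ e

  adj? : ∀ u v → Dec (BFAdj d u v)
  adj? (l , c) (l′ , c′) =
    map′ (λ (l~l′ , c~c′) → consecutive⇒adj l~l′ c~c′)
         (λ u~v → adj⇒consecutive u~v , adj⇒agreeExcept u~v)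
         (((toℕ l′ ≟ℕ suc (toℕ l)) ⊎-dec (toℕ l ≟ℕ suc (toℕ l′))) ×-dec agreeExcept? c c′)

  _≟ᵥ_ : DecidableEquality (BFVertex d)
  _≟ᵥ_ = Productₚ.≡-dec Finₚ._≟_ (Vecₚ.≡-dec Boolₚ._≟_)

  vertices : List (BFVertex d)
  vertices = cartesianProduct (allFin (suc d)) (allVecs d)

  ∈-vertices : ∀ v → v ∈ vertices
  ∈-vertices (l , c) = ∈ₚ.∈-cartesianProduct⁺ (∈ₚ.∈-allFin l) (∈-allVecs c)

  open ShortestWalks _≟ᵥ_ adj? vertices ∈-vertices public using (shortestWalk)

  -- Stepping down from level m + 1 may set bit m freely, so from level n one reaches every
  -- bottom column that agrees with the start on the bits ≥ n.
  descend : ∀ n {l : Fin (suc d)} → toℕ l ≡ n → ∀ {a c} → (∀ j → n ≤ toℕ j → lookup a j ≡ lookup c j) →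
            Walk (l , a) (bottom , c)
  descend zero {Fin.zero} _ {a} agree =
    subst (λ c → Walk (bottom , a) (bottom , c)) (lookup-ext λ j → agree j z≤n) (nil _)
  descend (suc n) {Fin.suc l} l≡n {a} {c} agree =
    cons step (descend n (trans (Finₚ.toℕ-inject₁ l) (suc-injective l≡n)) agree′)
    where
    a′ = a [ l ]≔ lookup c l
    step : BFAdj d (Fin.suc l , a) (inject₁ l , a′)
    step = inj₂ (agreeExcept⇒edge (cong suc (sym (Finₚ.toℕ-inject₁ l)))
                   (agreeExcept-reindex (sym (Finₚ.toℕ-inject₁ l)) (agreeExcept-sym (update-agreeExcept a l _))))
    agree′ : ∀ j → n ≤ toℕ j → lookup a′ j ≡ lookup c j
    agree′ j n≤j with j Finₚ.≟ l
    ... | yes refl = Vecₚ.lookup∘update j a _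
    ... | no  j≢l  = trans (Vecₚ.lookup∘update′ j≢l a _)
                           (agree j (≤∧≢⇒< n≤j λ n≡j →
                             j≢l (Finₚ.toℕ-injective (trans (sym n≡j) (sym (suc-injective l≡n))))))

  toBottom : ∀ l c → Walk (l , c) (bottom , c)
  toBottom l c = descend (toℕ l) refl λ _ _ → refl

  topToBottom : ∀ a c → Walk (top , a) (bottom , c)
  topToBottom a c = descend d (Finₚ.toℕ-fromℕ d) λ j d≤j → contradiction (Finₚ.toℕ<n j) (≤⇒≯ d≤j)

  connecting : ∀ u v → Walk u v
  connecting (l , c) (l′ , c′) =
    toBottom l c ++ʷ (reverseʷ adj-sym (topToBottom c′ c)
                 ++ʷ (topToBottom c′ c′ ++ʷ reverseʷ adj-sym (toBottom l′ c′)))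

  -- (l⁻ , c) and (l⁺ , c) are at distance 2 and (l , c) is their only common neighbour.
  interior∉ : ∀ {X} → IsTotalMutualVisibilitySet X → ∀ {l⁻ l l⁺ : Fin (suc d)} {c} →
              toℕ l ≡ suc (toℕ l⁻) → toℕ l⁺ ≡ suc (toℕ l) → (l , c) ∉ X
  interior∉ {X} tmv {l⁻} {l} {l⁺} {c} l≡1+l⁻ l⁺≡1+l l∈X with
    commonNeighbour∉ tmv {l⁻ , c} {l⁺ , c}
      (λ eq → m≢1+n+m (toℕ l⁻) (trans (cong (toℕ ∘ proj₁) eq) l⁺≡2+l⁻))
      (λ adj → consecutive-2+ (subst (Consecutive (toℕ l⁻)) l⁺≡2+l⁻ (adj⇒consecutive adj)))
      (consecutive⇒adj (inj₁ l≡1+l⁻) agreeExcept-refl)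
      (consecutive⇒adj (inj₁ l⁺≡1+l) agreeExcept-refl)
    where l⁺≡2+l⁻ = trans l⁺≡1+l (cong suc l≡1+l⁻)
  ... | (lᵥ , cᵥ) , l⁻~v , v~l⁺ , v∉X = v∉X (subst (_∈ X) (sym (cong₂ _,_ lᵥ≡l cᵥ≡c)) l∈X)
    where
    m = toℕ l⁻
    l⁺≡2+m = trans l⁺≡1+l (cong suc l≡1+l⁻)
    lᵥ≡1+m : toℕ lᵥ ≡ suc m
    lᵥ≡1+m = consecutive-between (adj⇒consecutive l⁻~v)
                                 (subst (Consecutive (toℕ lᵥ)) l⁺≡2+m (adj⇒consecutive v~l⁺))
    lᵥ≡l : lᵥ ≡ l
    lᵥ≡l = Finₚ.toℕ-injective (trans lᵥ≡1+m (sym l≡1+l⁻))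
    cᵥ≡c : cᵥ ≡ c
    cᵥ≡c = agreeExcept-twoBits
      (agreeExcept-reindex (⊓-≡suc lᵥ≡1+m) (agreeExcept-sym (adj⇒agreeExcept l⁻~v)))
      (agreeExcept-reindex (trans (⊓-≡suc (trans l⁺≡2+m (cong suc (sym lᵥ≡1+m)))) lᵥ≡1+m)
                           (adj⇒agreeExcept v~l⁺))
      (1+n≢n ∘ sym)

module PositiveDimension (d′ : ℕ) where
  d : ℕ
  d = suc d′
  open BF d
  open GraphProperties (BFVertex d) (BFAdj d)
  open Butterfly d

  -- Level 0 (b = false) and level d (b = true); inner b is the adjacent level, and boundaryBit b
  -- the only bit an edge at boundary b can change.
  boundary : Bool → Fin (suc d)
  boundary false = bottom
  boundary true  = top

  boundaryBit : Bool → Fin d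
  boundaryBit false = Fin.zero
  boundaryBit true  = fromℕ d′

  inner : Bool → Fin (suc d)
  inner false = Fin.suc Fin.zero
  inner true  = inject₁ (fromℕ d′)

  side : Fin (suc d) → Bool
  side Fin.zero    = false
  side (Fin.suc _) = true

  neighbour-bit : ∀ b {l : Fin (suc d)} → Consecutive (toℕ l) (toℕ (boundary b)) →
                  toℕ l ⊓ toℕ (boundary b) ≡ toℕ (boundaryBit b)
  neighbour-bit false {l} _ = ⊓-zeroʳ (toℕ l)
  neighbour-bit true {l} (inj₁ top≡1+l) = begin
    toℕ l ⊓ toℕ top      ≡⟨ ⊓-≡suc top≡1+l ⟩
    toℕ l                ≡⟨ suc-injective (trans (sym top≡1+l) (Finₚ.toℕ-fromℕ d)) ⟩
    d′                   ≡⟨ Finₚ.toℕ-fromℕ d′ ⟨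
    toℕ (fromℕ d′)       ∎
    where open ≡-Reasoning
  neighbour-bit true {l} (inj₂ l≡1+top) =
    contradiction (subst (_< suc d) (trans l≡1+top (cong suc (Finₚ.toℕ-fromℕ d))) (Finₚ.toℕ<n l)) (n≮n (suc d))

  inner-consecutive : ∀ b → Consecutive (toℕ (inner b)) (toℕ (boundary b))
  inner-consecutive false = inj₂ refl
  inner-consecutive true  =
    inj₁ (trans (Finₚ.toℕ-fromℕ d)
                (cong suc (sym (trans (Finₚ.toℕ-inject₁ (fromℕ d′)) (Finₚ.toℕ-fromℕ d′)))))

  inner-bit : ∀ b → toℕ (inner b) ⊓ toℕ (boundary b) ≡ toℕ (boundaryBit b)
  inner-bit b = neighbour-bit b (inner-consecutive b)

  adj-boundary-agreeExcept : ∀ b {u c c′} → AgreeExcept (toℕ (boundaryBit b)) c c′ →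
                             BFAdj d u (boundary b , c) → BFAdj d u (boundary b , c′)
  adj-boundary-agreeExcept b c~c′ u~v =
    consecutive⇒adj u~boundary
      (agreeExcept-reindex (sym bit≡) (agreeExcept-trans (agreeExcept-reindex bit≡ (adj⇒agreeExcept u~v)) c~c′))
    where
    u~boundary = adj⇒consecutive u~v
    bit≡ = neighbour-bit b u~boundary

  boundaryCode : BFVertex d → Vec Bool d
  boundaryCode (l , c) = side l ∷ removeAt c (boundaryBit (side l))

  boundaryVertex : Vec Bool d → BFVertex d
  boundaryVertex (b ∷ t) = boundary b , insertAt t (boundaryBit b) false

  boundaryCode∘boundaryVertex : ∀ v → boundaryCode (boundaryVertex v) ≡ v
  boundaryCode∘boundaryVertex (false ∷ t) = refl
  boundaryCode∘boundaryVertex (true  ∷ t) = cong (true ∷_) (Vecₚ.removeAt-insertAt t (fromℕ d′) false)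

  X₀ : List (BFVertex d)
  X₀ = map boundaryVertex (allVecs d)

  ∈X₀⇒ : ∀ {l c} → (l , c) ∈ X₀ → l ≡ boundary (side l) × lookup c (boundaryBit (side l)) ≡ false
  ∈X₀⇒ v∈X₀ with ∈ₚ.∈-map⁻ boundaryVertex v∈X₀
  ... | false ∷ t , _ , refl = refl , refl
  ... | true  ∷ t , _ , refl = refl , Vecₚ.insertAt-lookup t (fromℕ d′) false

  X₀-unique : Unique X₀
  X₀-unique = Uniqueₚ.map⁺ injective (allVecs-unique d)
    where
    injective : ∀ {v w} → boundaryVertex v ≡ boundaryVertex w → v ≡ w
    injective {v} {w} eq = begin
      v                                  ≡⟨ boundaryCode∘boundaryVertex v ⟨
      boundaryCode (boundaryVertex v)    ≡⟨ cong boundaryCode eq ⟩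
      boundaryCode (boundaryVertex w)    ≡⟨ boundaryCode∘boundaryVertex w ⟩
      w                                  ∎
      where open ≡-Reasoning

  length-X₀ : length X₀ ≡ 2 ^ d
  length-X₀ = trans (length-map boundaryVertex (allVecs d)) (length-allVecs d)

  substitute : ∀ {v} → v ∈ X₀ → ∃ λ v* → v* ∉ X₀ × (∀ {u} → BFAdj d u v → BFAdj d u v*)
  substitute {l , c} v∈X₀ = (l , c*) , c*∉X₀ , sameNeighbours
    where
    k = boundaryBit (side l)
    c* = c [ k ]≔ true
    sameNeighbours : ∀ {u} → BFAdj d u (l , c) → BFAdj d u (l , c*)
    sameNeighbours = subst (λ l′ → ∀ {u} → BFAdj d u (l′ , c) → BFAdj d u (l′ , c*))
                           (sym (proj₁ (∈X₀⇒ v∈X₀)))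
                           (adj-boundary-agreeExcept (side l) (update-agreeExcept c k true))
    c*∉X₀ : (l , c*) ∉ X₀
    c*∉X₀ v*∈X₀ = contradiction (trans (sym (Vecₚ.lookup∘update k c true)) (proj₂ (∈X₀⇒ v*∈X₀))) λ ()

  X₀-totalMutualVisibility : IsTotalMutualVisibilitySet X₀
  X₀-totalMutualVisibility = Rerouting.totalMutualVisibility _≟ᵥ_ adj-sym X₀ substitute
                               λ u v → shortestWalk (connecting u v)

  module _ {X : List (BFVertex d)} (tmv : IsTotalMutualVisibilitySet X) where

    -- Two boundary vertices differing only in the boundary bit are the only common
    -- neighbours of their two neighbours on the inner level.
    boundaryTwins : ∀ b {c c′} → AgreeExcept (toℕ (boundaryBit b)) c c′ →
                    (boundary b , c) ∈ X → (boundary b , c′) ∈ X → c ≡ c′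
    boundaryTwins b {c} {c′} c~c′ c∈X c′∈X with Vecₚ.≡-dec Boolₚ._≟_ c c′
    ... | yes c≡c′ = c≡c′
    ... | no  c≢c′ with
      commonNeighbour∉ tmv {inner b , c} {inner b , c′}
        (λ eq → c≢c′ (cong proj₂ eq))
        (λ adj → consecutive-irrefl (adj⇒consecutive adj))
        (consecutive⇒adj (inner-consecutive b) (agreeExcept-reindex (sym (inner-bit b)) c~c′))
        (consecutive⇒adj (consecutive-sym (inner-consecutive b)) agreeExcept-refl)
    ...   | (lᵥ , cᵥ) , x~v , v~u , v∉X with lᵥ Finₚ.≟ boundary b
    ...     | yes refl
      with agreeExcept-dichotomy (agreeExcept-sym (agreeExcept-reindex (inner-bit b) (adj⇒agreeExcept x~v)))
                                 c~c′ c≢c′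
    ...       | inj₁ refl = contradiction c∈X v∉X
    ...       | inj₂ refl = contradiction c′∈X v∉X
    boundaryTwins b {c} {c′} c~c′ c∈X c′∈X | no c≢c′ | (lᵥ , cᵥ) , x~v , v~u , v∉X | no lᵥ≢boundary =
      contradiction (agreeExcept-twoBits c~c′ᵥ c~c′ bits≢) c≢c′
      where
      c~c′ᵥ = agreeExcept-trans (adj⇒agreeExcept x~v)
                                (agreeExcept-reindex (⊓-comm (toℕ lᵥ) (toℕ (inner b))) (adj⇒agreeExcept v~u))
      bits≢ : toℕ (inner b) ⊓ toℕ lᵥ ≢ toℕ (boundaryBit b)
      bits≢ eq = lᵥ≢boundary (Finₚ.toℕ-injective
        (consecutive-⊓-injective (adj⇒consecutive x~v) (inner-consecutive b) (trans eq (sym (inner-bit b)))))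

    onBoundary : ∀ {l c} → (l , c) ∈ X → ∃ λ b → l ≡ boundary b
    onBoundary {Fin.zero} _ = false , refl
    onBoundary {Fin.suc l} l∈X with d′ ≟ℕ toℕ l
    ... | yes d′≡l = true , cong Fin.suc (Finₚ.toℕ-injective (trans (sym d′≡l) (sym (Finₚ.toℕ-fromℕ d′))))
    ... | no  d′≢l = contradiction l∈X
                       (interior∉ tmv {inject₁ l} {Fin.suc l} {Fin.suc (Fin.suc (lower₁ l d′≢l))}
                          (cong suc (sym (Finₚ.toℕ-inject₁ l))) (cong (suc ∘ suc) (Finₚ.toℕ-lower₁ l d′≢l)))

    boundaryCode-injectiveOn : ∀ {u v} → u ∈ X → v ∈ X → boundaryCode u ≡ boundaryCode v → u ≡ v
    boundaryCode-injectiveOn {l , c} {l′ , c′} u∈X v∈X eq with onBoundary u∈X | onBoundary v∈X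
    ... | false , refl | false , refl = cong (bottom ,_) (boundaryTwins false agree u∈X v∈X)
      where agree = removeAt-≡⇒agreeExcept c c′ Fin.zero (Vecₚ.∷-injectiveʳ eq)
    ... | true  , refl | true  , refl = cong (top ,_) (boundaryTwins true agree u∈X v∈X)
      where agree = removeAt-≡⇒agreeExcept c c′ (fromℕ d′) (Vecₚ.∷-injectiveʳ eq)
    ... | false , refl | true  , refl with () ← Vecₚ.∷-injectiveˡ eq
    ... | true  , refl | false , refl with () ← Vecₚ.∷-injectiveˡ eq

    length≤2^d : Unique X → length X ≤ 2 ^ d
    length≤2^d X-unique = begin
      length X                    ≡⟨ length-map boundaryCode X ⟨
      length (map boundaryCode X) ≤⟨ Unique⇒length≤ codes-unique (λ {v} _ → ∈-allVecs v) ⟩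
      length (allVecs d)          ≡⟨ length-allVecs d ⟩
      2 ^ d                       ∎
      where
      open ≤-Reasoning
      codes-unique = Unique-map⁺-injectiveOn boundaryCode boundaryCode-injectiveOn X-unique

theorem5 : (d : ℕ) → 1 ≤ d → BF.TotalMutualVisibilityNumberIs d (2 ^ d)
theorem5 (suc d′) _ =
  (X₀ , X₀-unique , X₀-totalMutualVisibility , length-X₀) , λ X X-unique tmv → length≤2^d tmv X-unique
  where open PositiveDimension d′
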